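{- Let $M\in\mathbb{R}^{k\times n}$, $\vec w\in\mathbb{R}^k$, and let $Q\in\mathbb{R}[x_1,\dots,x_n]$ be a polynomial of degree at most 2 whose homogeneous degree-2 part is $\vec x^{\intercal}A\vec x$ with $A\in\mathbb{R}^{n\times n}$. Let $A'$ be an $(M,M)$-perturbation of $A$, and let $A^*\in\mathbb{R}^{n\times n}$ be a matrix which agrees with $A'$ in all off-diagonal entries. Then there is a polynomial $Q^*\in\mathbb{R}[x_1,\dots,x_n]$ of degree at most 2 with homogeneous degree-2 part $\vec x^{\intercal}A^*\vec x$ such that $Q^*(\vec\xi)=Q(\vec\xi)$ for all $\vec\xi\in\{ -1,1\}^n$ with $M\vec\xi=\vec w$. In particular, for a sequence $\vec\xi\in\{ -1,1\}^n$ of independent Rademacher random variables, \[\Pr[Q(\vec\xi)=0\text{ and }M\vec\xi=\vec w]=\Pr[Q^*(\vec\xi)=0\text{ and }M\vec\xi=\vec w].\]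
   Context: For matrices $A\in\mathbb{R}^{n\times m}$, $T\in\mathbb{R}^{k\times m}$, $U\in\mathbb{R}^{k\times n}$, a $(T,U)$-perturbation of $A$ is a matrix of the form $A+LT+U^{\intercal}R$ for some $L\in\mathbb{R}^{n\times k}$ and $R\in\mathbb{R}^{k\times m}$ (i.e., obtained from $A$ by adding linear combinations of rows of $T$ to its rows and linear combinations of rows of $U$ to its columns). A Rademacher random variable takes values $\pm1$ with probability $1/2$ each. -}

module Defs where

open import Level using (_⊔_)
open import Algebra.Bundles using (CommutativeRing)
open import Data.Fin using (Fin)
open import Data.Bool using (Bool; true; false)
open import Data.Product using (Σ; ∃; ∃-syntax)

module Over {c ℓ} (R : CommutativeRing c ℓ) where
  open CommutativeRing R
  open import Algebra.Properties.Monoid.Sum +-monoid using (sum)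

  Mat : ∀ (m n : _) → Set c
  Mat m n = Fin m → Fin n → Carrier

  Vect : ∀ (n : _) → Set c
  Vect n = Fin n → Carrier

  mulVec : ∀ {k n} → Mat k n → Vect n → Vect k
  mulVec M x l = sum (λ j → M l j * x j)

  IsPerturbation : ∀ {k n m} → Mat k m → Mat k n → Mat n m → Mat n m → Set (c ⊔ ℓ)
  IsPerturbation {k} {n} {m} T U A A' =
    Σ (Mat n k) λ L → Σ (Mat k m) λ R' →
      ∀ i j → A' i j ≈ (A i j + sum (λ l → L i l * T l j)) + sum (λ l → U l i * R' l j)

  -- value of the degree-≤2 polynomial  xᵀ A x + bᵀ x + c₀  at x
  -- (every polynomial of degree ≤ 2 with homogeneous degree-2 part xᵀAx
  --  is of this form for a unique linear part b and constant c₀)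
  evalQ : ∀ {n} → Mat n n → Vect n → Carrier → Vect n → Carrier
  evalQ A b c₀ x =
    (sum (λ i → sum (λ j → x i * A i j * x j)) + sum (λ i → b i * x i)) + c₀

  pm : Bool → Carrier
  pm true = 1#
  pm false = - 1#

-- Write A′ = A + L M + Mᵀ B and A* = A′ + D with D diagonal. For the quadratic form
-- q_X(x) = xᵀ X x we have q_{L M}(x) = (L (M x))ᵀ x and q_{Mᵀ B}(x) = (Bᵀ (M x))ᵀ x, which on the
-- slice M x = w are the linear forms (L w)ᵀ x and (Bᵀ w)ᵀ x, while q_D(x) = Σ D i i x i² = tr D
-- on the cube x i = ±1. Hence Q* := Q with linear part b − L w − Bᵀ w and constant c₀ − tr D
-- agrees with Q on {ξ ∈ {±1}ⁿ | M ξ = w}.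
module Submission where

open import Defs
open import Algebra.Bundles using (CommutativeRing)
open import Data.Fin using (Fin)
open import Data.Bool using (Bool)
open import Data.Product using (Σ; _×_)
open import Function using (_∘_; _⇔_)
open import Relation.Binary.PropositionalEquality using (_≢_)

open import Data.Nat using (ℕ; suc)
open import Data.Fin using (punchIn)
open import Data.Bool using (true; false)
open import Data.Fin.Properties using (punchInᵢ≢i)
open import Data.Product using (_,_)
open import Function.Bundles using (mk⇔)
import Algebra.Solver.CommutativeMonoid as CommutativeMonoidSolver
import Relation.Binary.PropositionalEquality as ≡

module QuadraticForms {c ℓ} (R : CommutativeRing c ℓ) where
  open CommutativeRing R
  open Over R
  open import Algebra.Properties.Semiring.Sum semiring
    using (sum; sum-cong-≋; sum-replicate-zero; sum-remove; ∑-distrib-+; ∑-comm; *-distribˡ-sum; *-distribʳ-sum)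
  open import Algebra.Properties.Ring ring using (-1*x≈-x; -‿involutive)
  open import Algebra.Properties.Group +-group using (//-rightDividesˡ)
  open CommutativeMonoidSolver +-commutativeMonoid using (solve; _⊕_; _⊜_)
  open CommutativeMonoidSolver *-commutativeMonoid using () renaming (solve to solve*; _⊕_ to _⊛_; _⊜_ to _⊜*_)
  open import Relation.Binary.Reasoning.Setoid setoid

  private variable
    k m n : ℕ

  infixl 7 _⊗_
  _⊗_ : Mat m k → Mat k n → Mat m n
  (A ⊗ B) i j = sum (λ l → A i l * B l j)

  _ᵀ : Mat m n → Mat n m
  (A ᵀ) i j = A j i

  dot : Vect n → Vect n → Carrier
  dot b x = sum (λ i → b i * x i)

  quad : Mat n n → Vect n → Carrier
  quad A x = sum (λ i → sum (λ j → x i * A i j * x j))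

  trace : Mat n n → Carrier
  trace A = sum (λ i → A i i)

  IsDiagonal : Mat n n → Set ℓ
  IsDiagonal D = ∀ i j → i ≢ j → D i j ≈ 0#

  sum-cong : {f g : Vect n} → (∀ i → f i ≈ g i) → sum f ≈ sum g
  sum-cong = sum-cong-≋

  sum-zero : (f : Vect n) → (∀ i → f i ≈ 0#) → sum f ≈ 0#
  sum-zero {n} f f≈0 = trans (sum-cong f≈0) (sum-replicate-zero n)

  sum-supported : ∀ {n} (f : Vect n) i → (∀ j → j ≢ i → f j ≈ 0#) → sum f ≈ f i
  sum-supported {suc _} f i f≈0 = begin
    sum f                              ≈⟨ sum-remove f ⟩
    f i + sum (λ j → f (punchIn i j))  ≈⟨ +-congˡ (sum-zero _ (λ j → f≈0 _ (punchInᵢ≢i i j))) ⟩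
    f i + 0#                           ≈⟨ +-identityʳ (f i) ⟩
    f i                                ∎

  dot-distribˡ-+ : (a b x : Vect n) → dot (λ i → a i + b i) x ≈ dot a x + dot b x
  dot-distribˡ-+ a b x =
    trans (sum-cong (λ i → distribʳ (x i) (a i) (b i))) (∑-distrib-+ (λ i → a i * x i) (λ i → b i * x i))

  quad-cong : {A B : Mat n n} → (∀ i j → A i j ≈ B i j) → (x : Vect n) → quad A x ≈ quad B x
  quad-cong A≈B x = sum-cong (λ i → sum-cong (λ j → *-congʳ (*-congˡ (A≈B i j))))

  quad-distrib-+ : (A B : Mat n n) (x : Vect n) →
    quad (λ i j → A i j + B i j) x ≈ quad A x + quad B x
  quad-distrib-+ A B x = begin
    quad (λ i j → A i j + B i j) x
      ≈⟨ sum-cong (λ i → sum-cong (λ j → trans (*-congʳ (distribˡ (x i) (A i j) (B i j)))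
                                               (distribʳ (x j) (x i * A i j) (x i * B i j)))) ⟩
    sum (λ i → sum (λ j → x i * A i j * x j + x i * B i j * x j))
      ≈⟨ sum-cong (λ i → ∑-distrib-+ (λ j → x i * A i j * x j) (λ j → x i * B i j * x j)) ⟩
    sum (λ i → sum (λ j → x i * A i j * x j) + sum (λ j → x i * B i j * x j))
      ≈⟨ ∑-distrib-+ (λ i → sum (λ j → x i * A i j * x j)) (λ i → sum (λ j → x i * B i j * x j)) ⟩
    quad A x + quad B x ∎

  quad-ᵀ : (A : Mat n n) (x : Vect n) → quad (A ᵀ) x ≈ quad A x
  quad-ᵀ A x = trans (∑-comm (λ i j → x i * A j i * x j))
    (sum-cong (λ j → sum-cong (λ i → solve* 3 (λ a y z → (y ⊛ a) ⊛ z ⊜* (z ⊛ a) ⊛ y) refl (A j i) (x i) (x j))))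

  quad-⊗ : (L : Mat n k) (T : Mat k n) (x : Vect n) →
    quad (L ⊗ T) x ≈ dot (mulVec L (mulVec T x)) x
  quad-⊗ L T x = sum-cong λ i → begin
    sum (λ j → x i * sum (λ l → L i l * T l j) * x j)
      ≈⟨ sum-cong (λ j → trans (*-congʳ (*-comm (x i) _)) (*-assoc _ (x i) (x j))) ⟩
    sum (λ j → sum (λ l → L i l * T l j) * (x i * x j))
      ≈⟨ sum-cong (λ j → *-distribʳ-sum (x i * x j) (λ l → L i l * T l j)) ⟩
    sum (λ j → sum (λ l → L i l * T l j * (x i * x j)))
      ≈⟨ ∑-comm (λ j l → L i l * T l j * (x i * x j)) ⟩
    sum (λ l → sum (λ j → L i l * T l j * (x i * x j)))
      ≈⟨ sum-cong (λ l → sum-cong (λ j → regroup (L i l) (T l j) (x i) (x j))) ⟩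
    sum (λ l → sum (λ j → L i l * (T l j * x j) * x i))
      ≈⟨ sum-cong (λ l → sym (trans (*-congʳ (*-distribˡ-sum (L i l) (λ j → T l j * x j)))
                                    (*-distribʳ-sum (x i) (λ j → L i l * (T l j * x j))))) ⟩
    sum (λ l → L i l * mulVec T x l * x i)
      ≈⟨ sym (*-distribʳ-sum (x i) (λ l → L i l * mulVec T x l)) ⟩
    mulVec L (mulVec T x) i * x i ∎
    where
    regroup : ∀ a b y z → a * b * (y * z) ≈ a * (b * z) * y
    regroup = solve* 4 (λ a b y z → (a ⊛ b) ⊛ (y ⊛ z) ⊜* (a ⊛ (b ⊛ z)) ⊛ y) refl

  quad-ᵀ⊗ : (U : Mat k n) (B : Mat k n) (x : Vect n) →
    quad (U ᵀ ⊗ B) x ≈ dot (mulVec (B ᵀ) (mulVec U x)) x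
  quad-ᵀ⊗ U B x = begin
    quad (U ᵀ ⊗ B) x      ≈⟨ quad-ᵀ (U ᵀ ⊗ B) x ⟨
    quad ((U ᵀ ⊗ B) ᵀ) x  ≈⟨ quad-cong (λ i j → sum-cong (λ l → *-comm (U l j) (B l i))) x ⟩
    quad (B ᵀ ⊗ U) x      ≈⟨ quad-⊗ (B ᵀ) U x ⟩
    dot (mulVec (B ᵀ) (mulVec U x)) x ∎

  quad-diagonal : {D : Mat n n} → IsDiagonal D → (x : Vect n) → (∀ i → x i * x i ≈ 1#) →
    quad D x ≈ trace D
  quad-diagonal {D = D} D-diag x x²≈1 = sum-cong λ i → begin
    sum (λ j → x i * D i j * x j)
      ≈⟨ sum-supported _ i (λ j j≢i → trans (*-congʳ (trans (*-congˡ (D-diag i j (j≢i ∘ ≡.sym))) (zeroʳ (x i))))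
                                             (zeroˡ (x j))) ⟩
    x i * D i i * x i  ≈⟨ *-congʳ (*-comm (x i) (D i i)) ⟩
    D i i * x i * x i  ≈⟨ *-assoc (D i i) (x i) (x i) ⟩
    D i i * (x i * x i) ≈⟨ *-congˡ (x²≈1 i) ⟩
    D i i * 1#          ≈⟨ *-identityʳ (D i i) ⟩
    D i i ∎

  pm-square : ∀ b → pm b * pm b ≈ 1#
  pm-square true  = *-identityˡ 1#
  pm-square false = trans (-1*x≈-x (- 1#)) (-‿involutive 1#)

  quad-perturbation : (M : Mat k n) (w : Vect k) (A A′ A* : Mat n n) (L : Mat n k) (B : Mat k n) →
    (∀ i j → A′ i j ≈ (A i j + (L ⊗ M) i j) + (M ᵀ ⊗ B) i j) →
    (∀ i j → i ≢ j → A* i j ≈ A′ i j) →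
    (x : Vect n) → (∀ i → x i * x i ≈ 1#) → (∀ l → mulVec M x l ≈ w l) →
    quad A* x ≈ (quad A x + dot (λ i → mulVec L w i + mulVec (B ᵀ) w i) x) + trace (λ i j → A* i j - A′ i j)
  quad-perturbation {k} {n} M w A A′ A* L B A′-decomp A*≈A′ x x²≈1 Mx≈w = begin
    quad A* x
      ≈⟨ quad-cong (λ i j → trans (sym (//-rightDividesˡ (A′ i j) (A* i j)))
                                  (trans (+-comm (D i j) (A′ i j)) (+-congʳ (A′-decomp i j)))) x ⟩
    quad (λ i j → ((A i j + (L ⊗ M) i j) + (M ᵀ ⊗ B) i j) + D i j) x
      ≈⟨ trans (quad-distrib-+ (λ i j → (A i j + (L ⊗ M) i j) + (M ᵀ ⊗ B) i j) D x)
               (+-congʳ (trans (quad-distrib-+ (λ i j → A i j + (L ⊗ M) i j) (M ᵀ ⊗ B) x)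
                               (+-congʳ (quad-distrib-+ A (L ⊗ M) x)))) ⟩
    ((quad A x + quad (L ⊗ M) x) + quad (M ᵀ ⊗ B) x) + quad D x
      ≈⟨ +-cong (+-cong (+-congˡ (trans (quad-⊗ L M x) (on-slice L)))
                        (trans (quad-ᵀ⊗ M B x) (on-slice (B ᵀ))))
                (quad-diagonal D-diagonal x x²≈1) ⟩
    ((quad A x + dot (mulVec L w) x) + dot (mulVec (B ᵀ) w) x) + trace D
      ≈⟨ +-congʳ (trans (+-assoc _ _ _) (+-congˡ (sym (dot-distribˡ-+ (mulVec L w) (mulVec (B ᵀ) w) x)))) ⟩
    (quad A x + dot (λ i → mulVec L w i + mulVec (B ᵀ) w i) x) + trace D ∎
    where
    D : Mat n n
    D i j = A* i j - A′ i j

    D-diagonal : IsDiagonal D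
    D-diagonal i j i≢j = trans (+-congʳ (A*≈A′ i j i≢j)) (-‿inverseʳ (A′ i j))

    on-slice : (N : Mat n k) → dot (mulVec N (mulVec M x)) x ≈ dot (mulVec N w) x
    on-slice N = sum-cong {n = n} (λ i → *-congʳ (sum-cong {n = k} (λ l → *-congˡ (Mx≈w l))))

  evalQ-compensate : (A A* : Mat n n) (b s : Vect n) (c₀ e : Carrier) (x : Vect n) →
    quad A* x ≈ (quad A x + dot s x) + e →
    evalQ A* (λ i → b i - s i) (c₀ - e) x ≈ evalQ A b c₀ x
  evalQ-compensate A A* b s c₀ e x quad-A* = begin
    (quad A* x + dot (λ i → b i - s i) x) + (c₀ - e)
      ≈⟨ +-congʳ (+-congʳ quad-A*) ⟩
    (((quad A x + dot s x) + e) + dot (λ i → b i - s i) x) + (c₀ - e)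
      ≈⟨ solve 5 (λ q t u v z → (((q ⊕ t) ⊕ u) ⊕ v) ⊕ z ⊜ (q ⊕ (v ⊕ t)) ⊕ (z ⊕ u)) refl
               (quad A x) (dot s x) e (dot (λ i → b i - s i) x) (c₀ - e) ⟩
    (quad A x + (dot (λ i → b i - s i) x + dot s x)) + ((c₀ - e) + e)
      ≈⟨ +-cong (+-congˡ linear-part) (//-rightDividesˡ e c₀) ⟩
    (quad A x + dot b x) + c₀ ∎
    where
    linear-part : dot (λ i → b i - s i) x + dot s x ≈ dot b x
    linear-part = trans (sym (dot-distribˡ-+ (λ i → b i - s i) s x))
                        (sum-cong (λ i → *-congʳ (//-rightDividesˡ (s i) (b i))))

lemma5p3 : ∀ {c ℓ} (R : CommutativeRing c ℓ) →
    let open CommutativeRing R in let open Over R in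
    ∀ {k n} (M : Mat k n) (w : Vect k) (A : Mat n n) (b : Vect n) (c₀ : Carrier)
    (A′ A* : Mat n n) →
    IsPerturbation M M A A′ →
    (∀ i j → i ≢ j → A* i j ≈ A′ i j) →
    Σ (Vect n) λ b* → Σ Carrier λ c* →
    (∀ (ξ : Fin n → Bool) → (∀ l → mulVec M (pm ∘ ξ) l ≈ w l) →
    evalQ A* b* c* (pm ∘ ξ) ≈ evalQ A b c₀ (pm ∘ ξ))
    ×
    (∀ (ξ : Fin n → Bool) →
    ((evalQ A b c₀ (pm ∘ ξ) ≈ 0#) × (∀ l → mulVec M (pm ∘ ξ) l ≈ w l))
    ⇔ ((evalQ A* b* c* (pm ∘ ξ) ≈ 0#) × (∀ l → mulVec M (pm ∘ ξ) l ≈ w l)))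
lemma5p3 R {n = n} M w A b c₀ A′ A* (L , B , A′-decomp) A*≈A′ = b* , c* , agree , λ ξ → mk⇔
  (λ (Q≈0 , Mξ≈w) → trans (agree ξ Mξ≈w) Q≈0 , Mξ≈w)
  (λ (Q*≈0 , Mξ≈w) → trans (sym (agree ξ Mξ≈w)) Q*≈0 , Mξ≈w)
  where
  open CommutativeRing R
  open Over R
  open QuadraticForms R

  s : Vect n
  s i = mulVec L w i + mulVec (B ᵀ) w i

  e : Carrier
  e = trace (λ i j → A* i j - A′ i j)

  b* : Vect n
  b* i = b i - s i

  c* : Carrier
  c* = c₀ - e

  agree : ∀ ξ → (∀ l → mulVec M (pm ∘ ξ) l ≈ w l) → evalQ A* b* c* (pm ∘ ξ) ≈ evalQ A b c₀ (pm ∘ ξ)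
  agree ξ Mξ≈w = evalQ-compensate A A* b s c₀ e (pm ∘ ξ)
    (quad-perturbation M w A A′ A* L B A′-decomp A*≈A′ (pm ∘ ξ) (pm-square ∘ ξ) Mξ≈w)
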